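{- For any parameters $T_{\max},\delta,k\in\mathbb{N}^+$ and any static graph $G=(V,E)$, there is a Discoverer algorithm that wins the graph discovery game in $|V|\cdot T_{\max}$ rounds.
   Context: A simple temporal graph $(V,E,\lambda)$ with lifetime $T_{\max}$ is a finite simple undirected graph $(V,E)$ with labeling $\lambda\colon E\to\{1,\dots,T_{\max}\}$; edge $e$ exists only at time $\lambda(e)$. SIR model with parameter $\delta$: given seeds $S\subseteq V\times\{0,\dots,T_{\max}\}$, nodes start susceptible; a seed $(v,t)$ infects $v$ at time $t$ (if susceptible); a susceptible $u$ becomes infected at time $t$ iff a neighbor $v$ is infectious at time $t$ and $\lambda(uv)=t$ (by exactly one such neighbor); a node infected at time $t$ is infectious at $t+1,\dots,t+\delta$ and resistant afterwards. Infection logs record who infected whom when. Graph discovery game, parameters $T_{\max},\delta,k,n$: the Adversary fixes $n$ nodes and static edges $E$; the Discoverer learns $V$ and $E$. In each round the Discoverer submits at most $k$ seed infections and the Adversary answers with an infection log, choosing labels adaptively but keeping all answers consistent with at least one temporal graph on $(V,E)$. When the Discoverer stops it submits a temporal graph; the Adversary wins if it can exhibit a different temporal graph on $(V,E)$ consistent with all logs, otherwise the Discoverer wins. -}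

module Defs where

open import Data.Nat using (ℕ; zero; suc; _+_; _*_; _≤_; _<_)
open import Data.Fin using (Fin)
import Data.Fin as F
open import Data.List using (List; []; _∷_; length; lookup; _∷ʳ_)
open import Data.List.Membership.Propositional using (_∈_)
open import Data.List.Relation.Unary.All using (All)
open import Data.List.Relation.Unary.Unique.Propositional using (Unique)
open import Data.Maybe using (Maybe; just; nothing)
open import Data.Product using (Σ; ∃; _×_; _,_; proj₁; proj₂)
open import Data.Sum using (_⊎_)
open import Data.Empty using (⊥)
open import Relation.Binary.PropositionalEquality using (_≡_)

-- Simplicity: every pair has u < v (no loops, one
-- canonical orientation) and the list has no duplicates.

Edges : ℕ → Set
Edges n = List (Fin n × Fin n)

SimpleGraph : (n : ℕ) → Edges n → Set
SimpleGraph n E = All (λ p → proj₁ p F.< proj₂ p) E × Unique E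

Joins : {n : ℕ} (E : Edges n) → Fin (length E) → Fin n → Fin n → Set
Joins E e u v = lookup E e ≡ (u , v) ⊎ lookup E e ≡ (v , u)

Labeling : {n : ℕ} → Edges n → Set
Labeling E = Fin (length E) → ℕ

ValidLabeling : (Tmax : ℕ) {n : ℕ} (E : Edges n) → Labeling E → Set
ValidLabeling Tmax E lab = ∀ e → 1 ≤ lab e × lab e ≤ Tmax

Seeds : ℕ → Set
Seeds n = List (Fin n × ℕ)

data Cause (n : ℕ) : Set where
  seed : Cause n
  from : Fin n → Cause n

-- an infection log: for each node, nothing (never infected), or the
-- time of its infection together with who infected it
Log : ℕ → Set
Log n = Fin n → Maybe (ℕ × Cause n)

Infectious : (δ : ℕ) {n : ℕ} → Log n → Fin n → ℕ → Set
Infectious δ L u t = Σ ℕ λ tu → Σ (Cause _) λ c → L u ≡ just (tu , c) × tu < t × t ≤ tu + δ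

InfectedBy : {n : ℕ} → Log n → Fin n → ℕ → Set
InfectedBy L v t = Σ ℕ λ t' → Σ (Cause _) λ c → L v ≡ just (t' , c) × t' ≤ t

ValidLog : (δ : ℕ) {n : ℕ} (E : Edges n) → Labeling E → Seeds n → Log n → Set
ValidLog δ {n} E lab S L =
  (∀ v t → L v ≡ just (t , seed) → (v , t) ∈ S)
  × (∀ v u t → L v ≡ just (t , from u) →
       Σ (Fin (length E)) λ e → Joins E e u v × lab e ≡ t × Infectious δ L u t)
  -- Together with the two clauses
  -- above this says v is infected exactly at the first available event.
  × (∀ v t → (v , t) ∈ S → InfectedBy L v t)
  × (∀ v u e → Joins E e u v → Infectious δ L u (lab e) → InfectedBy L v (lab e))

Round : {n : ℕ} → Edges n → Set
Round {n} E = Seeds n × Log n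

History : {n : ℕ} → Edges n → Set
History E = List (Round E)

ConsistentWith : (Tmax δ : ℕ) {n : ℕ} (E : Edges n) → Labeling E → History E → Set
ConsistentWith Tmax δ E lab h =
  ValidLabeling Tmax E lab × All (λ r → ValidLog δ E lab (proj₁ r) (proj₂ r)) h

Consistent : (Tmax δ : ℕ) {n : ℕ} (E : Edges n) → History E → Set
Consistent Tmax δ E h = Σ (Labeling E) λ lab → ConsistentWith Tmax δ E lab h

data Move {n : ℕ} (E : Edges n) : Set where
  query : Seeds n → Move E
  stop  : Labeling E → Move E

Strategy : {n : ℕ} → Edges n → Set
Strategy E = History E → Move E

ValidSeeds : (Tmax k : ℕ) {n : ℕ} → Seeds n → Set
ValidSeeds Tmax k S = length S ≤ k × All (λ p → proj₂ p ≤ Tmax) S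

FinalWin : (Tmax δ : ℕ) {n : ℕ} (E : Edges n) → History E → Labeling E → Set
FinalWin Tmax δ E h g =
  ∀ lab → ConsistentWith Tmax δ E lab h → ∀ e → lab e ≡ g e

-- the strategy wins from history h using at most r further rounds,
-- against every adaptive Adversary (any answer log keeping the history
-- consistent with at least one temporal graph on (V,E))
mutual
  WinsWithin : (Tmax δ k : ℕ) {n : ℕ} (E : Edges n) → Strategy E → History E → ℕ → Set
  WinsWithin Tmax δ k E σ h r = WinsMove Tmax δ k E σ h r (σ h)

  WinsMove : (Tmax δ k : ℕ) {n : ℕ} (E : Edges n) → Strategy E → History E → ℕ → Move E → Set
  WinsMove Tmax δ k E σ h r (stop g) = FinalWin Tmax δ E h g
  WinsMove Tmax δ k E σ h zero (query S) = ⊥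
  WinsMove Tmax δ k {n} E σ h (suc r) (query S) =
    ValidSeeds Tmax k S ×
    (∀ (L : Log n) → Consistent Tmax δ E (h ∷ʳ (S , L)) →
       WinsWithin Tmax δ k E σ (h ∷ʳ (S , L)) r)

-- Seed a single node a at time s.  Every infection time in the log is then at least s,
-- and a is the only node infected at time s, so a node b is infected at time s + 1
-- exactly when ab is an edge with label s + 1.  Running one round for every pair
-- (a , s) with s < Tmax thus reveals every label: for an edge ab with a < b,
-- λ(ab) = s + 1 for the unique s whose round infects b at time s + 1.

module Submission where

open import Defs
open import Data.Nat using (ℕ; zero; suc; pred; _+_; _*_; _≤_; _<_; s≤s; >-nonZero)
open import Data.Nat.Properties
  using (_≟_; ≤-refl; ≤-trans; ≤-antisym; <⇒≤; <⇒≱; ≤∧≢⇒<; ≤-pred; +-comm; +-monoʳ-≤; suc-pred; 1+n≢n)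
open import Data.Nat.Induction using (<-rec)
open import Data.Fin using (Fin)
import Data.Fin as F
import Data.Fin.Properties as FinP
open import Data.List using (List; []; _∷_; [_]; _++_; _∷ʳ_; length; lookup; map; drop; cartesianProduct; allFin; upTo)
open import Data.List.Properties using (length-++; length-map; length-tabulate; length-upTo; map-++; ++-assoc; ++-identityʳ)
import Data.List.Properties as ListP
open import Data.List.Membership.Propositional using (_∈_; find; lose)
open import Data.List.Membership.Propositional.Properties
  using (∈-lookup; ∈-map⁺; ∈-map⁻; ∈-cartesianProduct⁺; ∈-cartesianProduct⁻; ∈-upTo⁺; ∈-upTo⁻; ∈-allFin)
open import Data.List.Relation.Unary.All as All using (All; []; _∷_)
import Data.List.Relation.Unary.All.Properties as AllP
open import Data.List.Relation.Unary.Any using (Any; here; any?)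
open import Data.List.Relation.Unary.AllPairs using ([]; _∷_)
open import Data.List.Relation.Unary.Unique.Propositional using (Unique)
open import Data.Maybe using (Maybe; just; nothing)
open import Data.Product using (Σ; _×_; _,_; proj₁; proj₂)
import Data.Product.Properties as ProductP
open import Data.Sum using (inj₁; inj₂)
open import Data.Empty using (⊥-elim)
open import Level using (Level)
open import Relation.Nullary using (yes; no; _×-dec_)
open import Relation.Unary using (Pred; Decidable)
open import Relation.Binary.PropositionalEquality
  using (_≡_; _≢_; refl; sym; trans; cong; cong₂; subst; module ≡-Reasoning)

private
  variable
    ℓ ℓ₁ ℓ₂ : Level
    A : Set ℓ₁
    B : Set ℓ₂

lookup-injective : {xs : List A} → Unique xs → ∀ i j → lookup xs i ≡ lookup xs j → i ≡ j
lookup-injective (_ ∷ _) F.zero F.zero _ = refl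
lookup-injective (x≢ ∷ _) F.zero (F.suc j) eq = ⊥-elim (All.lookup x≢ (∈-lookup j) eq)
lookup-injective (x≢ ∷ _) (F.suc i) F.zero eq = ⊥-elim (All.lookup x≢ (∈-lookup i) (sym eq))
lookup-injective (_ ∷ unique) (F.suc i) (F.suc j) eq = cong F.suc (lookup-injective unique i j eq)

length-cartesianProduct : (xs : List A) (ys : List B) →
  length (cartesianProduct xs ys) ≡ length xs * length ys
length-cartesianProduct [] ys = refl
length-cartesianProduct (x ∷ xs) ys = begin
  length (map (x ,_) ys ++ cartesianProduct xs ys)
    ≡⟨ length-++ (map (x ,_) ys) ⟩
  length (map (x ,_) ys) + length (cartesianProduct xs ys)
    ≡⟨ cong₂ _+_ (length-map (x ,_) ys) (length-cartesianProduct xs ys) ⟩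
  length ys + length xs * length ys ∎
  where open ≡-Reasoning

drop-length-++ : (xs : List A) {ys : List A} → drop (length xs) (xs ++ ys) ≡ ys
drop-length-++ [] = refl
drop-length-++ (_ ∷ xs) = drop-length-++ xs

lastBelow : {P : Pred ℕ ℓ} → Decidable P → ℕ → ℕ
lastBelow P? zero = 0
lastBelow P? (suc m) with P? m
... | yes _ = suc m
... | no _ = lastBelow P? m

lastBelow-unique : {P : Pred ℕ ℓ} (P? : Decidable P) {bound s x : ℕ} → s < bound → P s →
  (∀ {s′} → P s′ → suc s′ ≡ x) → lastBelow P? bound ≡ x
lastBelow-unique P? {suc m} (s≤s s≤m) ps unique with P? m
... | yes pm = unique pm
... | no ¬pm = lastBelow-unique P? (≤∧≢⇒< s≤m λ { refl → ¬pm ps }) ps unique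

module _ {n : ℕ} {E : Edges n} (simple : SimpleGraph n E) where

  edge-ordered : ∀ {e u v} → lookup E e ≡ (u , v) → u F.< v
  edge-ordered {e} le = subst (λ p → proj₁ p F.< proj₂ p) le (All.lookup (proj₁ simple) (∈-lookup e))

  joins-unique : ∀ {e e′ u v} → lookup E e ≡ (u , v) → Joins E e′ u v → e′ ≡ e
  joins-unique le (inj₁ le′) = lookup-injective (proj₂ simple) _ _ (trans le′ (sym le))
  joins-unique le (inj₂ le′) = ⊥-elim (FinP.<-asym (edge-ordered le) (edge-ordered le′))

-- 0 is a junk value for a node that is never infected
infectionTime : {C : Set} → Maybe (ℕ × C) → ℕ
infectionTime nothing = 0
infectionTime (just (t , _)) = t

infectionTime-suc : {C : Set} (m : Maybe (ℕ × C)) {t : ℕ} →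
  infectionTime m ≡ suc t → Σ C λ c → m ≡ just (suc t , c)
infectionTime-suc (just (_ , c)) refl = c , refl

module SingleSeed {δ n : ℕ} {E : Edges n} {lab : Labeling E} {a : Fin n} {s : ℕ} {L : Log n}
                  (valid : ValidLog δ E lab [ (a , s) ] L) where

  private
    fromSeed : ∀ {v t} → L v ≡ just (t , seed) → (v , t) ∈ [ (a , s) ]
    fromSeed {v} {t} = proj₁ valid v t

    fromNeighbour : ∀ {v u t} → L v ≡ just (t , from u) →
      Σ (Fin (length E)) λ e → Joins E e u v × lab e ≡ t × Infectious δ L u t
    fromNeighbour {v} {u} {t} = proj₁ (proj₂ valid) v u t

    seedTaken : InfectedBy L a s
    seedTaken = proj₁ (proj₂ (proj₂ valid)) a s (here refl)

    exposureTaken : ∀ {v u e} → Joins E e u v → Infectious δ L u (lab e) → InfectedBy L v (lab e)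
    exposureTaken {v} {u} {e} = proj₂ (proj₂ (proj₂ valid)) v u e

  seed-time-≤ : ∀ t {w c} → L w ≡ just (t , c) → s ≤ t
  seed-time-≤ = <-rec _ step
    where
    step : ∀ t → (∀ {t′} → t′ < t → ∀ {w c} → L w ≡ just (t′ , c) → s ≤ t′) →
      ∀ {w c} → L w ≡ just (t , c) → s ≤ t
    step t _ {c = seed} Lw with fromSeed Lw
    ... | here refl = ≤-refl
    step t earlier {c = from u} Lw with fromNeighbour Lw
    ... | _ , _ , _ , tu , _ , Lu , tu<t , _ = ≤-trans (earlier tu<t Lu) (<⇒≤ tu<t)

  seed-time-unique : ∀ {w c} → L w ≡ just (s , c) → w ≡ a
  seed-time-unique {c = seed} Lw with fromSeed Lw
  ... | here refl = refl
  seed-time-unique {c = from u} Lw with fromNeighbour Lw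
  ... | _ , _ , _ , tu , _ , Lu , tu<s , _ = ⊥-elim (<⇒≱ tu<s (seed-time-≤ tu Lu))

  seed-infectious : 1 ≤ δ → Infectious δ L a (suc s)
  seed-infectious δ≥1 with seedTaken
  ... | t , c , La , t≤s with ≤-antisym t≤s (seed-time-≤ t La)
  ... | refl = s , c , La , ≤-refl , subst (_≤ s + δ) (+-comm s 1) (+-monoʳ-≤ s δ≥1)

  infected-next : 1 ≤ δ → ∀ {e b} → Joins E e a b → b ≢ a → lab e ≡ suc s →
    infectionTime (L b) ≡ suc s
  infected-next δ≥1 joins b≢a le
    with exposureTaken joins (subst (Infectious δ L a) (sym le) (seed-infectious δ≥1))
  ... | t , c , Lb , t≤ = trans (cong infectionTime Lb) (≤-antisym (subst (t ≤_) le t≤) s<t)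
    where
    s<t : s < t
    s<t = ≤∧≢⇒< (seed-time-≤ t Lb) λ { refl → b≢a (seed-time-unique Lb) }

  infected-next⁻¹ : ∀ {b c} → L b ≡ just (suc s , c) →
    Σ (Fin (length E)) λ e → Joins E e a b × lab e ≡ suc s
  infected-next⁻¹ {c = seed} Lb with fromSeed Lb
  ... | here eq = ⊥-elim (1+n≢n (cong proj₂ eq))
  infected-next⁻¹ {c = from u} Lb with fromNeighbour Lb
  ... | e , joins , le , tu , _ , Lu , tu<ss , _ with ≤-antisym (≤-pred tu<ss) (seed-time-≤ tu Lu)
  ... | refl with seed-time-unique Lu
  ... | refl = e , joins , le

module _ (Tmax δ : ℕ) {n : ℕ} (E : Edges n) where

  Reveals : History E → Fin n → Fin n → ℕ → Set
  Reveals h a b m = Any (λ r → proj₁ r ≡ [ (a , m) ] × infectionTime (proj₂ r b) ≡ suc m) h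

  reveals? : ∀ h a b → Decidable (Reveals h a b)
  reveals? h a b m = any? (λ r → ListP.≡-dec (ProductP.≡-dec F._≟_ _≟_) (proj₁ r) [ (a , m) ]
                                   ×-dec (infectionTime (proj₂ r b) ≟ suc m)) h

  decode : History E → Labeling E
  decode h e = lastBelow (reveals? h (proj₁ (lookup E e)) (proj₂ (lookup E e))) Tmax

  decode-correct : SimpleGraph n E → 1 ≤ δ → ∀ {h} →
    (∀ {a s} → s < Tmax → [ (a , s) ] ∈ map proj₁ h) → FinalWin Tmax δ E h (decode h)
  decode-correct simple δ≥1 {h} queried lab (valid-lab , valid-logs) e =
    sym (lastBelow-unique (reveals? h a b) s<Tmax revealed revealed-only-by-label)
    where
    a b : Fin n
    a = proj₁ (lookup E e)
    b = proj₂ (lookup E e)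

    s : ℕ
    s = pred (lab e)

    lab≡suc-s : lab e ≡ suc s
    lab≡suc-s = sym (suc-pred (lab e) {{>-nonZero (proj₁ (valid-lab e))}})

    s<Tmax : s < Tmax
    s<Tmax = subst (_≤ Tmax) lab≡suc-s (proj₂ (valid-lab e))

    b≢a : b ≢ a
    b≢a b≡a = FinP.<⇒≢ (edge-ordered simple refl) (sym b≡a)

    revealed : Reveals h a b s
    revealed with ∈-map⁻ proj₁ (queried s<Tmax)
    ... | (_ , L) , r∈h , refl =
      lose r∈h (refl , SingleSeed.infected-next {E = E} {lab} (All.lookup valid-logs r∈h) δ≥1 (inj₁ refl) b≢a lab≡suc-s)

    revealed-only-by-label : ∀ {s′} → Reveals h a b s′ → suc s′ ≡ lab e
    revealed-only-by-label rev with find rev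
    ... | (_ , L) , r∈h , refl , time with infectionTime-suc (L b) time
    ... | _ , Lb with SingleSeed.infected-next⁻¹ {E = E} {lab} (All.lookup valid-logs r∈h) Lb
    ... | e′ , joins , le′ = trans (sym le′) (cong lab (joins-unique simple refl joins))

module Schedule (Tmax δ k : ℕ) {n : ℕ} {E : Edges n}
                (plan : List (Seeds n)) (guess : History E → Labeling E) where

  nextMove : List (Seeds n) → History E → Move E
  nextMove [] h = stop (guess h)
  nextMove (S ∷ _) h = query S

  follow : Strategy E
  follow h = nextMove (drop (length h) plan) h

  follow-wins : All (ValidSeeds Tmax k) plan →
    (∀ h → map proj₁ h ≡ plan → FinalWin Tmax δ E h (guess h)) →
    WinsWithin Tmax δ k E follow [] (length plan)
  follow-wins valid-plan guess-wins = wins-from [] plan refl valid-plan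
    where
    remaining : ∀ h rest → map proj₁ h ++ rest ≡ plan → drop (length h) plan ≡ rest
    remaining h rest played = begin
      drop (length h) plan                              ≡⟨ cong₂ drop (sym (length-map proj₁ h)) (sym played) ⟩
      drop (length (map proj₁ h)) (map proj₁ h ++ rest) ≡⟨ drop-length-++ (map proj₁ h) ⟩
      rest ∎
      where open ≡-Reasoning

    wins-from : ∀ h rest → map proj₁ h ++ rest ≡ plan → All (ValidSeeds Tmax k) rest →
      WinsWithin Tmax δ k E follow h (length rest)
    wins-next : ∀ h rest → map proj₁ h ++ rest ≡ plan → All (ValidSeeds Tmax k) rest →
      WinsMove Tmax δ k E follow h (length rest) (nextMove rest h)

    wins-from h rest played valid =
      subst (λ xs → WinsMove Tmax δ k E follow h (length rest) (nextMove xs h))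
            (sym (remaining h rest played)) (wins-next h rest played valid)

    wins-next h [] played [] = guess-wins h (trans (sym (++-identityʳ (map proj₁ h))) played)
    wins-next h (S ∷ rest) played (valid-S ∷ valid) =
      valid-S , λ L _ → wins-from (h ∷ʳ (S , L)) rest (played′ L) valid
      where
      played′ : ∀ L → map proj₁ (h ∷ʳ (S , L)) ++ rest ≡ plan
      played′ L = begin
        map proj₁ (h ++ [ (S , L) ]) ++ rest     ≡⟨ cong (_++ rest) (map-++ proj₁ h [ (S , L) ]) ⟩
        (map proj₁ h ++ [ S ]) ++ rest           ≡⟨ ++-assoc (map proj₁ h) [ S ] rest ⟩
        map proj₁ h ++ S ∷ rest                  ≡⟨ played ⟩
        plan ∎
        where open ≡-Reasoning

singleSeedPlan : (n Tmax : ℕ) → List (Seeds n)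
singleSeedPlan n Tmax = map [_] (cartesianProduct (allFin n) (upTo Tmax))

length-singleSeedPlan : ∀ n Tmax → length (singleSeedPlan n Tmax) ≡ n * Tmax
length-singleSeedPlan n Tmax = begin
  length (singleSeedPlan n Tmax)                       ≡⟨ length-map [_] (cartesianProduct (allFin n) (upTo Tmax)) ⟩
  length (cartesianProduct (allFin n) (upTo Tmax))     ≡⟨ length-cartesianProduct (allFin n) (upTo Tmax) ⟩
  length (allFin n) * length (upTo Tmax)               ≡⟨ cong₂ _*_ (length-tabulate {n = n} (λ i → i)) (length-upTo Tmax) ⟩
  n * Tmax ∎
  where open ≡-Reasoning

singleSeedPlan-valid : ∀ {n Tmax k} → 1 ≤ k → All (ValidSeeds Tmax k) (singleSeedPlan n Tmax)
singleSeedPlan-valid {n} {Tmax} {k} k≥1 = AllP.map⁺ (All.tabulate valid)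
  where
  valid : ∀ {p} → p ∈ cartesianProduct (allFin n) (upTo Tmax) → ValidSeeds Tmax k [ p ]
  valid p∈ = k≥1 , <⇒≤ (∈-upTo⁻ (proj₂ (∈-cartesianProduct⁻ (allFin n) (upTo Tmax) p∈))) ∷ []

singleSeedPlan-complete : ∀ {n Tmax a s} → s < Tmax → [ (a , s) ] ∈ singleSeedPlan n Tmax
singleSeedPlan-complete {a = a} s<Tmax = ∈-map⁺ [_] (∈-cartesianProduct⁺ (∈-allFin a) (∈-upTo⁺ s<Tmax))

mainTheorem19 : (Tmax δ k : ℕ) → 1 ≤ Tmax → 1 ≤ δ → 1 ≤ k →
    (n : ℕ) (E : Edges n) → SimpleGraph n E →
    Σ (Strategy E) λ σ → WinsWithin Tmax δ k E σ [] (n * Tmax)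
mainTheorem19 Tmax δ k _ δ≥1 k≥1 n E simple =
  follow ,
  subst (WinsWithin Tmax δ k E follow []) (length-singleSeedPlan n Tmax)
    (follow-wins (singleSeedPlan-valid k≥1) λ h played →
      decode-correct Tmax δ E simple δ≥1 λ s<Tmax → subst (_ ∈_) (sym played) (singleSeedPlan-complete s<Tmax))
  where open Schedule Tmax δ k {E = E} (singleSeedPlan n Tmax) (decode Tmax δ E)
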